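{- Let $m,n$ be positive integers. Then $n^m \mid m^n + 1$ if and only if either $(m,n) = (2,3)$, or $(m,n) = (1,2)$, or $n = 1$ (with $m$ arbitrary). -}

module Defs where

{-# OPTIONS --safe #-}
-- For m = 1 the condition reads n ∣ 2. For even n and m ≥ 2, 4 ∣ nᵐ, while mⁿ + 1 is odd
-- when m is even and ≡ 2 (mod 4) when m is odd. For odd n ≥ 3, let p be the least prime
-- factor of n. The order of m modulo p divides gcd(2n, p − 1), which divides 2, so
-- p ∣ m² − 1; and p ∤ m − 1, as otherwise p ∣ (mⁿ + 1) − (mⁿ − 1) = 2. Hence p ∣ m + 1.
-- Writing n = pᵉ r with p ∤ r, lifting the exponent gives v_p(mⁿ + 1) = v_p(m + 1) + e; as
-- p^(em) ∣ nᵐ, this yields p^(e(m − 1)) ∣ m + 1, so 3^(m − 1) ≤ m + 1, whence m = 2, p = 3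
-- and e = 1. Finally, if r > 1 its least prime factor q ≠ 3 satisfies q ∣ 2⁶ − 1 = 7 · 9 by
-- the same order argument, so q = 7; but 2ⁿ + 1 is never divisible by 7.
module Submission where

open import Defs
open import Data.Empty using (⊥-elim)
open import Data.Integer using (ℤ; +_; 0ℤ; 1ℤ; ∣_∣)
  renaming (_+_ to _+ᶻ_; _-_ to _-ᶻ_; _*_ to _*ᶻ_; -_ to -ᶻ_; _^_ to _^ᶻ_)
import Data.Integer.Properties as ℤ
open import Data.Integer.Divisibility.Signed as ℤᵈ using (divides) renaming (_∣_ to _∣ᶻ_)
open import Data.Integer.Tactic.RingSolver using (solve-∀)
open import Data.Nat
  using (ℕ; zero; suc; _+_; _*_; _^_; _∸_; _≤_; _<_; z≤n; s≤s; _!; NonZero; >-nonZero; ≢-nonZero⁻¹;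
         n>1⇒nonTrivial; nonTrivial⇒n>1)
import Data.Nat.Properties as ℕ
open import Data.Nat.Properties using (_!*_!≢0)
open import Data.Nat.Combinatorics
  using (_C_; nCn≡1; nC1≡n; nCk+nC[k+1]≡[n+1]C[k+1]; k>n⇒nCk≡0; nCk≡n!/k![n-k]!; k![n∸k]!∣n!)
open import Data.Nat.Coprimality using (Coprime; coprime-divisor)
open import Data.Nat.Divisibility
  using (_∣_; divides; _∣?_; ∣-refl; ∣-trans; ∣m∣n⇒∣m+n; ∣m+n∣m⇒∣n; 1∣_; ∣1⇒≡1; 0∣⇒≡0; m∣m*n; n∣m*n;
         ∣m⇒∣m*n; ∣n⇒∣m*n; *-pres-∣; *-cancelˡ-∣; *-monoʳ-∣; ∣⇒≤)
open import Data.Nat.Divisibility.Core using (hasNonTrivialDivisor)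
open import Data.Nat.DivMod using (m*[n/m]≡n)
open import Data.Nat.GCD using (gcd; gcd-GCD; gcd[m,n]∣m; gcd[m,n]∣n; module Bézout)
open import Data.Nat.Induction using (<-wellFounded)
open import Data.Nat.Primality
  using (Prime; _Rough_; 2-rough; ∤⇒rough-suc; rough∧∣⇒prime; euclidsLemma; prime?; prime[2]; ¬prime[0];
         ¬prime[1]; prime⇒nonZero; prime⇒nonTrivial; prime⇒irreducible)
open import Data.Nat.Tactic.RingSolver using () renaming (solve-∀ to solveℕ-∀)
open import Data.Product using (_×_; _,_; ∃-syntax)
open import Data.Sum using (_⊎_; inj₁; inj₂)
import Data.Sum as Sum
open import Function using (_∘_)
open import Function.Bundles using (_⇔_; mk⇔)
open import Induction.WellFounded using (Acc; acc)
open import Relation.Binary.PropositionalEquality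
  using (_≡_; refl; sym; trans; cong; cong₂; subst; subst₂; module ≡-Reasoning)
open import Relation.Nullary using (¬_; yes; no)
open import Relation.Nullary.Decidable using (from-yes; from-no)

prime∤1 : ∀ {p} → Prime p → ¬ p ∣ 1
prime∤1 p-prime p∣1 = ¬prime[1] (subst Prime (∣1⇒≡1 p∣1) p-prime)

prime⇒2≤p : ∀ {p} → Prime p → 2 ≤ p
prime⇒2≤p {p} p-prime = nonTrivial⇒n>1 p ⦃ prime⇒nonTrivial p-prime ⦄

prime∣prime⇒≡ : ∀ {p q} → Prime p → Prime q → p ∣ q → p ≡ q
prime∣prime⇒≡ p-prime q-prime p∣q with prime⇒irreducible q-prime p∣q
... | inj₁ refl = ⊥-elim (¬prime[1] p-prime)
... | inj₂ p≡q  = p≡q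

∤2⇒odd : ∀ {n} → ¬ 2 ∣ n → ∃[ k ] n ≡ suc (2 * k)
∤2⇒odd {zero}        2∤n = ⊥-elim (2∤n (divides 0 refl))
∤2⇒odd {suc zero}    _   = 0 , refl
∤2⇒odd {suc (suc n)} 2∤n with ∤2⇒odd (λ 2∣n → 2∤n (∣m∣n⇒∣m+n (∣-refl {2}) 2∣n))
... | k , refl = suc k , cong (suc ∘ suc) (sym (ℕ.+-suc k (k + 0)))

∣m⇒∣mⁿ : ∀ {d m n} → 1 ≤ n → d ∣ m → d ∣ m ^ n
∣m⇒∣mⁿ {m = m} {suc n} _ d∣m = ∣m⇒∣m*n (m ^ n) d∣m

^-monoˡ-∣ : ∀ {m n} k → m ∣ n → m ^ k ∣ n ^ k
^-monoˡ-∣ zero    m∣n = ∣-refl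
^-monoˡ-∣ (suc k) m∣n = *-pres-∣ m∣n (^-monoˡ-∣ k m∣n)

p^k∣m*n⇒p∤n⇒p^k∣m : ∀ {p} → Prime p → ∀ k {m n} → p ^ k ∣ m * n → ¬ p ∣ n → p ^ k ∣ m
p^k∣m*n⇒p∤n⇒p^k∣m p-prime zero    {m}     _     _   = 1∣ m
p^k∣m*n⇒p∤n⇒p^k∣m {p} p-prime (suc k) {m} {n} p^k+1∣mn p∤n
  with euclidsLemma m n p-prime (∣-trans (m∣m*n (p ^ k)) p^k+1∣mn)
... | inj₂ p∣n = ⊥-elim (p∤n p∣n)
... | inj₁ (divides q refl) = subst (p * p ^ k ∣_) (ℕ.*-comm p q) (*-monoʳ-∣ p p^k∣q)
  where
  instance _ = prime⇒nonZero p-prime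
  p^k∣q : p ^ k ∣ q
  p^k∣q = p^k∣m*n⇒p∤n⇒p^k∣m p-prime k (*-cancelˡ-∣ p (subst (p * p ^ k ∣_) qpn≡pqn p^k+1∣mn)) p∤n
    where
    qpn≡pqn : q * p * n ≡ p * (q * n)
    qpn≡pqn = trans (cong (_* n) (ℕ.*-comm q p)) (ℕ.*-assoc p q n)

pos-^ : ∀ m n → (+ m) ^ᶻ n ≡ + (m ^ n)
pos-^ m zero    = refl
pos-^ m (suc n) = trans (cong (+ m *ᶻ_) (pos-^ m n)) (sym (ℤ.pos-* m (m ^ n)))

∣mⁿ+1⇒∣ᶻ : ∀ {d} m n → d ∣ m ^ n + 1 → + d ∣ᶻ (+ m) ^ᶻ n +ᶻ 1ℤ
∣mⁿ+1⇒∣ᶻ m n d∣mⁿ+1 = subst (λ z → _ ∣ᶻ z +ᶻ 1ℤ) (sym (pos-^ m n)) (ℤᵈ.∣ᵤ⇒∣ d∣mⁿ+1)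

*-pres-∣ᶻ : ∀ {i j k l} → i ∣ᶻ j → k ∣ᶻ l → i *ᶻ k ∣ᶻ j *ᶻ l
*-pres-∣ᶻ {i} {k = k} (divides a refl) (divides b refl) = divides (a *ᶻ b) (lemma a i b k)
  where
  lemma : ∀ a i b k → (a *ᶻ i) *ᶻ (b *ᶻ k) ≡ (a *ᶻ b) *ᶻ (i *ᶻ k)
  lemma = solve-∀

euclidsLemmaᶻ : ∀ i j {p} → Prime p → + p ∣ᶻ i *ᶻ j → + p ∣ᶻ i ⊎ + p ∣ᶻ j
euclidsLemmaᶻ i j p-prime p∣ij = Sum.map ℤᵈ.∣ᵤ⇒∣ ℤᵈ.∣ᵤ⇒∣
  (euclidsLemma ∣ i ∣ ∣ j ∣ p-prime (subst (_ ∣_) (ℤ.abs-* i j) (ℤᵈ.∣⇒∣ᵤ p∣ij)))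

p^k∣i*j⇒p∤j⇒p^k∣i : ∀ {p} → Prime p → ∀ k {i j} → + (p ^ k) ∣ᶻ i *ᶻ j → ¬ + p ∣ᶻ j → + (p ^ k) ∣ᶻ i
p^k∣i*j⇒p∤j⇒p^k∣i p-prime k {i} {j} p^k∣ij p∤j = ℤᵈ.∣ᵤ⇒∣ (p^k∣m*n⇒p∤n⇒p^k∣m p-prime k
  (subst (_ ∣_) (ℤ.abs-* i j) (ℤᵈ.∣⇒∣ᵤ p^k∣ij)) (λ p∣j → p∤j (ℤᵈ.∣ᵤ⇒∣ p∣j)))

∣X-1⇒∣X+1⇒∣2 : ∀ {k} X → k ∣ᶻ X -ᶻ 1ℤ → k ∣ᶻ X +ᶻ 1ℤ → k ∣ᶻ + 2
∣X-1⇒∣X+1⇒∣2 X k∣X-1 k∣X+1 = subst (_ ∣ᶻ_) (difference X) (ℤᵈ.∣m∣n⇒∣m-n k∣X+1 k∣X-1)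
  where
  difference : ∀ X → (X +ᶻ 1ℤ) -ᶻ (X -ᶻ 1ℤ) ≡ + 2
  difference = solve-∀

-- Geometric sums and multiplicative orders

geometricSum : ℤ → ℕ → ℤ
geometricSum y zero    = 0ℤ
geometricSum y (suc r) = geometricSum y r +ᶻ y ^ᶻ r

[y-1]*geometricSum≡yʳ-1 : ∀ y r → (y -ᶻ 1ℤ) *ᶻ geometricSum y r ≡ y ^ᶻ r -ᶻ 1ℤ
[y-1]*geometricSum≡yʳ-1 y zero    = ℤ.*-zeroʳ (y -ᶻ 1ℤ)
[y-1]*geometricSum≡yʳ-1 y (suc r) = begin
  (y -ᶻ 1ℤ) *ᶻ (geometricSum y r +ᶻ y ^ᶻ r)
    ≡⟨ ℤ.*-distribˡ-+ (y -ᶻ 1ℤ) (geometricSum y r) (y ^ᶻ r) ⟩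
  (y -ᶻ 1ℤ) *ᶻ geometricSum y r +ᶻ (y -ᶻ 1ℤ) *ᶻ y ^ᶻ r
    ≡⟨ cong (_+ᶻ (y -ᶻ 1ℤ) *ᶻ y ^ᶻ r) ([y-1]*geometricSum≡yʳ-1 y r) ⟩
  (y ^ᶻ r -ᶻ 1ℤ) +ᶻ (y -ᶻ 1ℤ) *ᶻ y ^ᶻ r
    ≡⟨ telescope y (y ^ᶻ r) ⟩
  y *ᶻ y ^ᶻ r -ᶻ 1ℤ
    ∎
  where
  open ≡-Reasoning
  telescope : ∀ y Y → (Y -ᶻ 1ℤ) +ᶻ (y -ᶻ 1ℤ) *ᶻ Y ≡ y *ᶻ Y -ᶻ 1ℤ
  telescope = solve-∀

x-1∣xⁿ-1 : ∀ x n → x -ᶻ 1ℤ ∣ᶻ x ^ᶻ n -ᶻ 1ℤ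
x-1∣xⁿ-1 x n = divides (geometricSum x n)
  (trans (sym ([y-1]*geometricSum≡yʳ-1 x n)) (ℤ.*-comm (x -ᶻ 1ℤ) (geometricSum x n)))

∣x-1⇒∣xⁿ-1 : ∀ {k x} n → k ∣ᶻ x -ᶻ 1ℤ → k ∣ᶻ x ^ᶻ n -ᶻ 1ℤ
∣x-1⇒∣xⁿ-1 {x = x} n k∣x-1 = ℤᵈ.∣-trans k∣x-1 (x-1∣xⁿ-1 x n)

∣xᵈ-1⇒∣xⁿ-1 : ∀ {k x d n} → d ∣ n → k ∣ᶻ x ^ᶻ d -ᶻ 1ℤ → k ∣ᶻ x ^ᶻ n -ᶻ 1ℤ
∣xᵈ-1⇒∣xⁿ-1 {x = x} {d} (divides q refl) k∣xᵈ-1 =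
  subst (λ z → _ ∣ᶻ z -ᶻ 1ℤ) (trans (ℤ.^-*-assoc x d q) (cong (x ^ᶻ_) (ℕ.*-comm d q)))
    (∣x-1⇒∣xⁿ-1 q k∣xᵈ-1)

∣xᵐ⁺ⁿ-1⇒∣xⁿ-1⇒∣xᵐ-1 : ∀ {k x} m n → k ∣ᶻ x ^ᶻ (m + n) -ᶻ 1ℤ → k ∣ᶻ x ^ᶻ n -ᶻ 1ℤ → k ∣ᶻ x ^ᶻ m -ᶻ 1ℤ
∣xᵐ⁺ⁿ-1⇒∣xⁿ-1⇒∣xᵐ-1 {x = x} m n k∣xᵐ⁺ⁿ-1 k∣xⁿ-1 =
  subst (_ ∣ᶻ_) (peel (x ^ᶻ m) (x ^ᶻ n))
    (ℤᵈ.∣m∣n⇒∣m-n (subst (λ z → _ ∣ᶻ z -ᶻ 1ℤ) (ℤ.^-distribˡ-+-* x m n) k∣xᵐ⁺ⁿ-1)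
                  (ℤᵈ.∣n⇒∣m*n (x ^ᶻ m) k∣xⁿ-1))
  where
  peel : ∀ A B → (A *ᶻ B -ᶻ 1ℤ) -ᶻ A *ᶻ (B -ᶻ 1ℤ) ≡ A -ᶻ 1ℤ
  peel = solve-∀

∣xᵃ-1⇒∣xᵇ-1⇒∣x^gcd-1 : ∀ {k x} a b → k ∣ᶻ x ^ᶻ a -ᶻ 1ℤ → k ∣ᶻ x ^ᶻ b -ᶻ 1ℤ → k ∣ᶻ x ^ᶻ gcd a b -ᶻ 1ℤ
∣xᵃ-1⇒∣xᵇ-1⇒∣x^gcd-1 {k} {x} a b k∣xᵃ-1 k∣xᵇ-1 with Bézout.identity (gcd-GCD a b)
... | Bézout.+- u v eq = ∣xᵐ⁺ⁿ-1⇒∣xⁿ-1⇒∣xᵐ-1 (gcd a b) (v * b)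
  (subst (λ e → k ∣ᶻ x ^ᶻ e -ᶻ 1ℤ) (sym eq) (∣xᵈ-1⇒∣xⁿ-1 (n∣m*n u) k∣xᵃ-1)) (∣xᵈ-1⇒∣xⁿ-1 (n∣m*n v) k∣xᵇ-1)
... | Bézout.-+ u v eq = ∣xᵐ⁺ⁿ-1⇒∣xⁿ-1⇒∣xᵐ-1 (gcd a b) (u * a)
  (subst (λ e → k ∣ᶻ x ^ᶻ e -ᶻ 1ℤ) (sym eq) (∣xᵈ-1⇒∣xⁿ-1 (n∣m*n v) k∣xᵇ-1)) (∣xᵈ-1⇒∣xⁿ-1 (n∣m*n u) k∣xᵃ-1)

-- Fermat's little theorem

prime∤n! : ∀ {p n} → Prime p → n < p → ¬ p ∣ n !
prime∤n! {n = zero}  p-prime _   p∣1 = prime∤1 p-prime p∣1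
prime∤n! {n = suc n} p-prime n<p p∣n! with euclidsLemma (suc n) (n !) p-prime p∣n!
... | inj₁ p∣n+1 = ℕ.<⇒≱ n<p (∣⇒≤ p∣n+1)
... | inj₂ p∣n!′ = prime∤n! p-prime (ℕ.<⇒≤ n<p) p∣n!′

prime∣pCk : ∀ {p k} → Prime p → 0 < k → k < p → p ∣ p C k
prime∣pCk {suc p′} {k} p-prime 0<k k<p
  with euclidsLemma (k ! * (p ∸ k) !) (p C k) p-prime (subst (p ∣_) (sym k![p-k]!*pCk≡p!) (m∣m*n (p′ !)))
  where
  p = suc p′
  instance _ = k !* (p ∸ k) !≢0
  k![p-k]!*pCk≡p! : k ! * (p ∸ k) ! * (p C k) ≡ p !
  k![p-k]!*pCk≡p! = trans (cong (k ! * (p ∸ k) ! *_) (nCk≡n!/k![n-k]! (ℕ.<⇒≤ k<p)))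
    (m*[n/m]≡n (k![n∸k]!∣n! (ℕ.<⇒≤ k<p)))
... | inj₂ p∣pCk = p∣pCk
... | inj₁ p∣k!*[p-k]! with euclidsLemma (k !) ((suc p′ ∸ k) !) p-prime p∣k!*[p-k]!
...   | inj₁ p∣k!     = ⊥-elim (prime∤n! p-prime k<p p∣k!)
...   | inj₂ p∣[p-k]! = ⊥-elim (prime∤n! p-prime (ℕ.∸-monoʳ-< 0<k (ℕ.<⇒≤ k<p)) p∣[p-k]!)

binomialSum : ℤ → ℕ → ℕ → ℤ
binomialSum x n zero    = 1ℤ
binomialSum x n (suc k) = binomialSum x n k +ᶻ + (n C suc k) *ᶻ x ^ᶻ suc k

binomialSum-pascal : ∀ x n k →
  binomialSum x (suc n) (suc k) ≡ binomialSum x n (suc k) +ᶻ x *ᶻ binomialSum x n k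
binomialSum-pascal x n zero rewrite nC1≡n (suc n) | nC1≡n n = regroup (+ n) x
  where
  regroup : ∀ n x → 1ℤ +ᶻ (1ℤ +ᶻ n) *ᶻ (x *ᶻ 1ℤ) ≡ (1ℤ +ᶻ n *ᶻ (x *ᶻ 1ℤ)) +ᶻ x *ᶻ 1ℤ
  regroup = solve-∀
binomialSum-pascal x n (suc k) = begin
  binomialSum x (suc n) (suc k) +ᶻ + (suc n C suc (suc k)) *ᶻ (x *ᶻ X)
    ≡⟨ cong₂ (λ B c → B +ᶻ + c *ᶻ (x *ᶻ X))
             (binomialSum-pascal x n k) (sym (nCk+nC[k+1]≡[n+1]C[k+1] n (suc k))) ⟩
  (B₁ +ᶻ x *ᶻ B₀) +ᶻ (+ (n C suc k) +ᶻ + (n C suc (suc k))) *ᶻ (x *ᶻ X)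
    ≡⟨ regroup B₁ B₀ (+ (n C suc k)) (+ (n C suc (suc k))) x X ⟩
  (B₁ +ᶻ + (n C suc (suc k)) *ᶻ (x *ᶻ X)) +ᶻ x *ᶻ (B₀ +ᶻ + (n C suc k) *ᶻ X) ∎
  where
  open ≡-Reasoning
  X  = x ^ᶻ suc k
  B₀ = binomialSum x n k
  B₁ = binomialSum x n (suc k)
  regroup : ∀ B₁ B₀ c d x X → (B₁ +ᶻ x *ᶻ B₀) +ᶻ (c +ᶻ d) *ᶻ (x *ᶻ X)
                            ≡ (B₁ +ᶻ d *ᶻ (x *ᶻ X)) +ᶻ x *ᶻ (B₀ +ᶻ c *ᶻ X)
  regroup = solve-∀

binomial-theorem : ∀ x n → (1ℤ +ᶻ x) ^ᶻ n ≡ binomialSum x n n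
binomial-theorem x zero    = refl
binomial-theorem x (suc n) = begin
  (1ℤ +ᶻ x) *ᶻ (1ℤ +ᶻ x) ^ᶻ n            ≡⟨ cong ((1ℤ +ᶻ x) *ᶻ_) (binomial-theorem x n) ⟩
  (1ℤ +ᶻ x) *ᶻ B                          ≡⟨ distrib B x ⟩
  B +ᶻ x *ᶻ B                             ≡⟨ cong (_+ᶻ x *ᶻ B) (sym top-term-vanishes) ⟩
  binomialSum x n (suc n) +ᶻ x *ᶻ B       ≡⟨ sym (binomialSum-pascal x n n) ⟩
  binomialSum x (suc n) (suc n)           ∎
  where
  open ≡-Reasoning
  B = binomialSum x n n
  distrib : ∀ B x → (1ℤ +ᶻ x) *ᶻ B ≡ B +ᶻ x *ᶻ B
  distrib = solve-∀
  top-term-vanishes : binomialSum x n (suc n) ≡ B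
  top-term-vanishes =
    trans (cong (λ c → B +ᶻ + c *ᶻ x ^ᶻ suc n) (k>n⇒nCk≡0 (ℕ.n<1+n n))) (ℤ.+-identityʳ B)

p∣binomialSum-1 : ∀ {p} → Prime p → ∀ x k → k < p → + p ∣ᶻ binomialSum x p k -ᶻ 1ℤ
p∣binomialSum-1 p-prime x zero    _     = divides 0ℤ refl
p∣binomialSum-1 {p} p-prime x (suc k) k+1<p =
  subst (_ ∣ᶻ_) (regroup (binomialSum x p k) (+ (p C suc k)) (x ^ᶻ suc k))
  (ℤᵈ.∣m∣n⇒∣m+n (p∣binomialSum-1 p-prime x k (ℕ.<⇒≤ k+1<p))
                (ℤᵈ.∣m⇒∣m*n {m = + (p C suc k)} (x ^ᶻ suc k)
                            (ℤᵈ.∣ᵤ⇒∣ (prime∣pCk p-prime (s≤s z≤n) k+1<p))))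
  where
  regroup : ∀ B c X → (B -ᶻ 1ℤ) +ᶻ c *ᶻ X ≡ (B +ᶻ c *ᶻ X) -ᶻ 1ℤ
  regroup = solve-∀

freshmans-dream : ∀ {p} → Prime p → ∀ x → + p ∣ᶻ (1ℤ +ᶻ x) ^ᶻ p -ᶻ (1ℤ +ᶻ x ^ᶻ p)
freshmans-dream {zero}   p-prime x = ⊥-elim (¬prime[0] p-prime)
freshmans-dream {suc p′} p-prime x = subst (_ ∣ᶻ_) (sym eq) (p∣binomialSum-1 p-prime x p′ ℕ.≤-refl)
  where
  p = suc p′
  B = binomialSum x p p′
  split : ∀ B X → (B +ᶻ 1ℤ *ᶻ X) -ᶻ (1ℤ +ᶻ X) ≡ B -ᶻ 1ℤ
  split = solve-∀
  eq : (1ℤ +ᶻ x) ^ᶻ p -ᶻ (1ℤ +ᶻ x ^ᶻ p) ≡ B -ᶻ 1ℤ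
  eq = begin
    (1ℤ +ᶻ x) ^ᶻ p -ᶻ (1ℤ +ᶻ x ^ᶻ p)             ≡⟨ cong (_-ᶻ (1ℤ +ᶻ x ^ᶻ p)) (binomial-theorem x p) ⟩
    (B +ᶻ + (p C p) *ᶻ x ^ᶻ p) -ᶻ (1ℤ +ᶻ x ^ᶻ p)  ≡⟨ cong (λ c → (B +ᶻ + c *ᶻ x ^ᶻ p) -ᶻ (1ℤ +ᶻ x ^ᶻ p)) (nCn≡1 p) ⟩
    (B +ᶻ 1ℤ *ᶻ x ^ᶻ p) -ᶻ (1ℤ +ᶻ x ^ᶻ p)         ≡⟨ split B (x ^ᶻ p) ⟩
    B -ᶻ 1ℤ                                       ∎
    where open ≡-Reasoning

p∣aᵖ-a : ∀ {p} → Prime p → ∀ a → + p ∣ᶻ (+ a) ^ᶻ p -ᶻ + a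
p∣aᵖ-a {zero}   p-prime _       = ⊥-elim (¬prime[0] p-prime)
p∣aᵖ-a {suc p′} p-prime zero    = divides 0ℤ refl
p∣aᵖ-a {suc p′} p-prime (suc a) =
  subst (_ ∣ᶻ_) (regroup ((1ℤ +ᶻ + a) ^ᶻ suc p′) ((+ a) ^ᶻ suc p′) (+ a))
  (ℤᵈ.∣m∣n⇒∣m+n (freshmans-dream p-prime (+ a)) (p∣aᵖ-a p-prime a))
  where
  regroup : ∀ A B X → (A -ᶻ (1ℤ +ᶻ B)) +ᶻ (B -ᶻ X) ≡ A -ᶻ (1ℤ +ᶻ X)
  regroup = solve-∀

p∣aᵖ⁻¹-1 : ∀ {p a} → Prime p → ¬ p ∣ a → + p ∣ᶻ (+ a) ^ᶻ (p ∸ 1) -ᶻ 1ℤ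
p∣aᵖ⁻¹-1 {zero}       p-prime _   = ⊥-elim (¬prime[0] p-prime)
p∣aᵖ⁻¹-1 {suc p′} {a} p-prime p∤a
  with euclidsLemmaᶻ (+ a) ((+ a) ^ᶻ p′ -ᶻ 1ℤ) p-prime
         (subst (_ ∣ᶻ_) (factor (+ a) ((+ a) ^ᶻ p′)) (p∣aᵖ-a p-prime a))
  where
  factor : ∀ x X → x *ᶻ X -ᶻ x ≡ x *ᶻ (X -ᶻ 1ℤ)
  factor = solve-∀
... | inj₁ p∣a   = ⊥-elim (p∤a (ℤᵈ.∣⇒∣ᵤ p∣a))
... | inj₂ p∣aᵖ⁻¹-1 = p∣aᵖ⁻¹-1

-- Lifting the exponent

triangular : ℕ → ℕ
triangular zero    = 0
triangular (suc i) = triangular i + i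

triangular-odd : ∀ h → triangular (suc (2 * h)) ≡ suc (2 * h) * h
triangular-odd zero = refl
triangular-odd (suc h) = begin
  triangular (suc (2 * suc h))                          ≡⟨ cong (triangular ∘ suc) (ℕ.*-suc 2 h) ⟩
  triangular (suc (2 * h)) + suc (2 * h) + (2 + 2 * h)
    ≡⟨ cong (λ t → t + suc (2 * h) + (2 + 2 * h)) (triangular-odd h) ⟩
  suc (2 * h) * h + suc (2 * h) + (2 + 2 * h)           ≡⟨ regroup h ⟩
  suc (2 + 2 * h) * suc h                               ≡⟨ cong (λ k → suc k * suc h) (ℕ.*-suc 2 h) ⟨
  suc (2 * suc h) * suc h                               ∎
  where
  open ≡-Reasoning
  regroup : ∀ h → suc (2 * h) * h + suc (2 * h) + (2 + 2 * h) ≡ suc (2 + 2 * h) * suc h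
  regroup = solveℕ-∀

[y-1]²∣yⁱ-[1+i[y-1]] : ∀ y i → (y -ᶻ 1ℤ) *ᶻ (y -ᶻ 1ℤ) ∣ᶻ y ^ᶻ i -ᶻ (1ℤ +ᶻ + i *ᶻ (y -ᶻ 1ℤ))
[y-1]²∣yⁱ-[1+i[y-1]] y zero    = divides 0ℤ (vanish y)
  where
  vanish : ∀ y → 1ℤ -ᶻ (1ℤ +ᶻ 0ℤ *ᶻ (y -ᶻ 1ℤ)) ≡ 0ℤ *ᶻ ((y -ᶻ 1ℤ) *ᶻ (y -ᶻ 1ℤ))
  vanish = solve-∀
[y-1]²∣yⁱ-[1+i[y-1]] y (suc i) = subst (_ ∣ᶻ_) (regroup y (y ^ᶻ i) (+ i))
  (ℤᵈ.∣m∣n⇒∣m+n (ℤᵈ.∣n⇒∣m*n y ([y-1]²∣yⁱ-[1+i[y-1]] y i)) (ℤᵈ.∣n⇒∣m*n (+ i) ℤᵈ.∣-refl))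
  where
  regroup : ∀ y Y i → y *ᶻ (Y -ᶻ (1ℤ +ᶻ i *ᶻ (y -ᶻ 1ℤ))) +ᶻ i *ᶻ ((y -ᶻ 1ℤ) *ᶻ (y -ᶻ 1ℤ))
                    ≡ y *ᶻ Y -ᶻ (1ℤ +ᶻ (1ℤ +ᶻ i) *ᶻ (y -ᶻ 1ℤ))
  regroup = solve-∀

[y-1]²∣geometricSum-[i+Tᵢ[y-1]] : ∀ y i →
  (y -ᶻ 1ℤ) *ᶻ (y -ᶻ 1ℤ) ∣ᶻ geometricSum y i -ᶻ (+ i +ᶻ + triangular i *ᶻ (y -ᶻ 1ℤ))
[y-1]²∣geometricSum-[i+Tᵢ[y-1]] y zero    = divides 0ℤ (vanish y)
  where
  vanish : ∀ y → 0ℤ -ᶻ (0ℤ +ᶻ 0ℤ *ᶻ (y -ᶻ 1ℤ)) ≡ 0ℤ *ᶻ ((y -ᶻ 1ℤ) *ᶻ (y -ᶻ 1ℤ))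
  vanish = solve-∀
[y-1]²∣geometricSum-[i+Tᵢ[y-1]] y (suc i) =
  subst (_ ∣ᶻ_) (regroup (geometricSum y i) (y ^ᶻ i) (+ i) (+ triangular i) (y -ᶻ 1ℤ))
    (ℤᵈ.∣m∣n⇒∣m+n ([y-1]²∣geometricSum-[i+Tᵢ[y-1]] y i) ([y-1]²∣yⁱ-[1+i[y-1]] y i))
  where
  regroup : ∀ G Y i T t → (G -ᶻ (i +ᶻ T *ᶻ t)) +ᶻ (Y -ᶻ (1ℤ +ᶻ i *ᶻ t))
                        ≡ (G +ᶻ Y) -ᶻ ((1ℤ +ᶻ i) +ᶻ (T +ᶻ i) *ᶻ t)
  regroup = solve-∀

[y-1]∣geometricSum-r : ∀ y r → y -ᶻ 1ℤ ∣ᶻ geometricSum y r -ᶻ + r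
[y-1]∣geometricSum-r y r = subst (_ ∣ᶻ_) (regroup (geometricSum y r) (+ r) (+ triangular r) (y -ᶻ 1ℤ))
  (ℤᵈ.∣m∣n⇒∣m+n (ℤᵈ.∣-trans (ℤᵈ.∣m⇒∣m*n (y -ᶻ 1ℤ) ℤᵈ.∣-refl) ([y-1]²∣geometricSum-[i+Tᵢ[y-1]] y r))
                (ℤᵈ.∣n⇒∣m*n (+ triangular r) ℤᵈ.∣-refl))
  where
  regroup : ∀ G r T t → (G -ᶻ (r +ᶻ T *ᶻ t)) +ᶻ T *ᶻ t ≡ G -ᶻ r
  regroup = solve-∀

-- Modulo (y − 1)², geometricSum y p ≡ p + triangular p · (y − 1), and triangular p = p(p − 1)/2
-- is a multiple of p because p is odd.
p²∣geometricSumᵖ-p : ∀ {p y} → ¬ 2 ∣ p → + p ∣ᶻ y -ᶻ 1ℤ → + p *ᶻ + p ∣ᶻ geometricSum y p -ᶻ + p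
p²∣geometricSumᵖ-p {p} {y} 2∤p p∣y-1 with ∤2⇒odd 2∤p
... | h , refl = subst (_ ∣ᶻ_) (regroup (geometricSum y p) (+ p) (+ triangular p) (y -ᶻ 1ℤ))
  (ℤᵈ.∣m∣n⇒∣m+n p²∣remainder p²∣T[y-1])
  where
  regroup : ∀ G p T t → (G -ᶻ (p +ᶻ T *ᶻ t)) +ᶻ T *ᶻ t ≡ G -ᶻ p
  regroup = solve-∀
  p²∣remainder : + p *ᶻ + p ∣ᶻ geometricSum y p -ᶻ (+ p +ᶻ + triangular p *ᶻ (y -ᶻ 1ℤ))
  p²∣remainder = ℤᵈ.∣-trans (*-pres-∣ᶻ p∣y-1 p∣y-1) ([y-1]²∣geometricSum-[i+Tᵢ[y-1]] y p)
  ph≡T : + p *ᶻ + h ≡ + triangular p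
  ph≡T = trans (sym (ℤ.pos-* p h)) (cong +_ (sym (triangular-odd h)))
  p²∣T[y-1] : + p *ᶻ + p ∣ᶻ + triangular p *ᶻ (y -ᶻ 1ℤ)
  p²∣T[y-1] = subst (λ T → + p *ᶻ + p ∣ᶻ T *ᶻ (y -ᶻ 1ℤ)) ph≡T
    (*-pres-∣ᶻ (ℤᵈ.∣m⇒∣m*n (+ h) (ℤᵈ.∣-refl {+ p})) p∣y-1)

lift-coprime : ∀ {p r y} j → Prime p → ¬ p ∣ r → + p ∣ᶻ y -ᶻ 1ℤ →
               + (p ^ j) ∣ᶻ y ^ᶻ r -ᶻ 1ℤ → + (p ^ j) ∣ᶻ y -ᶻ 1ℤ
lift-coprime {p} {r} {y} j p-prime p∤r p∣y-1 p^j∣yʳ-1 = p^k∣i*j⇒p∤j⇒p^k∣i p-prime j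
  (subst (_ ∣ᶻ_) (sym ([y-1]*geometricSum≡yʳ-1 y r)) p^j∣yʳ-1) p∤G
  where
  cancel : ∀ G r → G -ᶻ (G -ᶻ r) ≡ r
  cancel = solve-∀
  p∤G : ¬ + p ∣ᶻ geometricSum y r
  p∤G p∣G = p∤r (ℤᵈ.∣⇒∣ᵤ (subst (_ ∣ᶻ_) (cancel (geometricSum y r) (+ r))
    (ℤᵈ.∣m∣n⇒∣m-n p∣G (ℤᵈ.∣-trans p∣y-1 ([y-1]∣geometricSum-r y r)))))

lift-odd-prime : ∀ {p y} j → Prime p → ¬ 2 ∣ p → + p ∣ᶻ y -ᶻ 1ℤ →
                 + (p ^ suc j) ∣ᶻ y ^ᶻ p -ᶻ 1ℤ → + (p ^ j) ∣ᶻ y -ᶻ 1ℤ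
lift-odd-prime {p} {y} j p-prime 2∤p p∣y-1 p^j+1∣yᵖ-1 with p²∣geometricSumᵖ-p 2∤p p∣y-1
... | divides c G-p≡cp² = p^k∣i*j⇒p∤j⇒p^k∣i p-prime j p^j∣[y-1]u p∤u
  where
  instance _ = prime⇒nonZero p-prime
  u = 1ℤ +ᶻ c *ᶻ + p
  factor : ∀ G p c → G -ᶻ p ≡ c *ᶻ (p *ᶻ p) → G ≡ p *ᶻ (1ℤ +ᶻ c *ᶻ p)
  factor G p c eq = trans (restore G p) (trans (cong (_+ᶻ p) eq) (collect c p))
    where
    restore : ∀ G p → G ≡ (G -ᶻ p) +ᶻ p
    restore = solve-∀
    collect : ∀ c p → c *ᶻ (p *ᶻ p) +ᶻ p ≡ p *ᶻ (1ℤ +ᶻ c *ᶻ p)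
    collect = solve-∀
  rearrange : ∀ t p u → t *ᶻ (p *ᶻ u) ≡ p *ᶻ (t *ᶻ u)
  rearrange = solve-∀
  yᵖ-1≡p[y-1]u : y ^ᶻ p -ᶻ 1ℤ ≡ + p *ᶻ ((y -ᶻ 1ℤ) *ᶻ u)
  yᵖ-1≡p[y-1]u = begin
    y ^ᶻ p -ᶻ 1ℤ                      ≡⟨ [y-1]*geometricSum≡yʳ-1 y p ⟨
    (y -ᶻ 1ℤ) *ᶻ geometricSum y p     ≡⟨ cong ((y -ᶻ 1ℤ) *ᶻ_) (factor (geometricSum y p) (+ p) c G-p≡cp²) ⟩
    (y -ᶻ 1ℤ) *ᶻ (+ p *ᶻ u)           ≡⟨ rearrange (y -ᶻ 1ℤ) (+ p) u ⟩
    + p *ᶻ ((y -ᶻ 1ℤ) *ᶻ u)           ∎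
    where open ≡-Reasoning
  p^j∣[y-1]u : + (p ^ j) ∣ᶻ (y -ᶻ 1ℤ) *ᶻ u
  p^j∣[y-1]u = ℤᵈ.*-cancelˡ-∣ (+ p) (subst₂ _∣ᶻ_ (ℤ.pos-* p (p ^ j)) yᵖ-1≡p[y-1]u p^j+1∣yᵖ-1)
  p∤u : ¬ + p ∣ᶻ u
  p∤u p∣u = prime∤1 p-prime (ℤᵈ.∣⇒∣ᵤ (ℤᵈ.∣m+n∣n⇒∣m {m = 1ℤ} p∣u (ℤᵈ.∣n⇒∣m*n c (ℤᵈ.∣-refl {+ p}))))

lifting-the-exponent : ∀ {p r y} → Prime p → ¬ 2 ∣ p → ¬ p ∣ r → + p ∣ᶻ y -ᶻ 1ℤ →
  ∀ e j → + (p ^ (j + e)) ∣ᶻ y ^ᶻ (p ^ e * r) -ᶻ 1ℤ → + (p ^ j) ∣ᶻ y -ᶻ 1ℤ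
lifting-the-exponent {p} {r} {y} p-prime 2∤p p∤r p∣y-1 zero j =
  lift-coprime j p-prime p∤r p∣y-1
  ∘ subst₂ (λ a b → + (p ^ a) ∣ᶻ y ^ᶻ b -ᶻ 1ℤ) (ℕ.+-identityʳ j) (ℕ.*-identityˡ r)
lifting-the-exponent {p} {r} {y} p-prime 2∤p p∤r p∣y-1 (suc e) j =
  lifting-the-exponent p-prime 2∤p p∤r p∣y-1 e j
  ∘ lift-odd-prime (j + e) p-prime 2∤p (∣x-1⇒∣xⁿ-1 (p ^ e * r) p∣y-1)
  ∘ subst₂ (λ a z → + (p ^ a) ∣ᶻ z -ᶻ 1ℤ) (ℕ.+-suc j e) yᵖᵉ⁺¹ʳ≡[yᵖᵉʳ]ᵖ
  where
  yᵖᵉ⁺¹ʳ≡[yᵖᵉʳ]ᵖ : y ^ᶻ (p * p ^ e * r) ≡ (y ^ᶻ (p ^ e * r)) ^ᶻ p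
  yᵖᵉ⁺¹ʳ≡[yᵖᵉʳ]ᵖ = trans (cong (y ^ᶻ_) (reorder p (p ^ e) r)) (sym (ℤ.^-*-assoc y (p ^ e * r) p))
    where
    reorder : ∀ p q r → p * q * r ≡ q * r * p
    reorder = solveℕ-∀

[-x]^odd : ∀ x k → (-ᶻ x) ^ᶻ suc (2 * k) ≡ -ᶻ x ^ᶻ suc (2 * k)
[-x]^odd x k = begin
  (-ᶻ x) *ᶻ (-ᶻ x) ^ᶻ (2 * k)   ≡⟨ cong ((-ᶻ x) *ᶻ_) (ℤ.^-*-assoc (-ᶻ x) 2 k) ⟨
  (-ᶻ x) *ᶻ ((-ᶻ x) ^ᶻ 2) ^ᶻ k  ≡⟨ cong (λ z → (-ᶻ x) *ᶻ z ^ᶻ k) (square-neg x) ⟩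
  (-ᶻ x) *ᶻ (x ^ᶻ 2) ^ᶻ k       ≡⟨ cong ((-ᶻ x) *ᶻ_) (ℤ.^-*-assoc x 2 k) ⟩
  (-ᶻ x) *ᶻ x ^ᶻ (2 * k)        ≡⟨ ℤ.neg-distribˡ-* x (x ^ᶻ (2 * k)) ⟨
  -ᶻ x ^ᶻ suc (2 * k)           ∎
  where
  open ≡-Reasoning
  square-neg : ∀ x → (-ᶻ x) *ᶻ ((-ᶻ x) *ᶻ 1ℤ) ≡ x *ᶻ (x *ᶻ 1ℤ)
  square-neg = solve-∀

-- Lifting the exponent for y = −x, which turns xⁿ + 1 into −(yⁿ − 1) since n is odd.
lifting-the-exponent⁺ : ∀ {p r x} → Prime p → ¬ 2 ∣ p → ¬ p ∣ r → + p ∣ᶻ x +ᶻ 1ℤ →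
  ∀ e j → ¬ 2 ∣ p ^ e * r → + (p ^ (j + e)) ∣ᶻ x ^ᶻ (p ^ e * r) +ᶻ 1ℤ → + (p ^ j) ∣ᶻ x +ᶻ 1ℤ
lifting-the-exponent⁺ {p} {r} {x} p-prime 2∤p p∤r p∣x+1 e j 2∤n p^j+e∣xⁿ+1 with ∤2⇒odd 2∤n
... | k , n≡2k+1 = subst (_ ∣ᶻ_) (ℤ.neg-involutive (x +ᶻ 1ℤ)) (ℤᵈ.∣m⇒∣-m p^j∣-[x+1])
  where
  -y-1≡-[y+1] : ∀ y → -ᶻ y -ᶻ 1ℤ ≡ -ᶻ (y +ᶻ 1ℤ)
  -y-1≡-[y+1] = solve-∀
  [-x]ⁿ-1≡-[xⁿ+1] : (-ᶻ x) ^ᶻ (p ^ e * r) -ᶻ 1ℤ ≡ -ᶻ (x ^ᶻ (p ^ e * r) +ᶻ 1ℤ)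
  [-x]ⁿ-1≡-[xⁿ+1] = begin
    (-ᶻ x) ^ᶻ (p ^ e * r) -ᶻ 1ℤ   ≡⟨ cong (λ n → (-ᶻ x) ^ᶻ n -ᶻ 1ℤ) n≡2k+1 ⟩
    (-ᶻ x) ^ᶻ suc (2 * k) -ᶻ 1ℤ   ≡⟨ cong (_-ᶻ 1ℤ) ([-x]^odd x k) ⟩
    -ᶻ x ^ᶻ suc (2 * k) -ᶻ 1ℤ     ≡⟨ cong (λ n → -ᶻ x ^ᶻ n -ᶻ 1ℤ) n≡2k+1 ⟨
    -ᶻ x ^ᶻ (p ^ e * r) -ᶻ 1ℤ     ≡⟨ -y-1≡-[y+1] (x ^ᶻ (p ^ e * r)) ⟩
    -ᶻ (x ^ᶻ (p ^ e * r) +ᶻ 1ℤ)   ∎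
    where open ≡-Reasoning
  p∣-x-1 : + p ∣ᶻ -ᶻ x -ᶻ 1ℤ
  p∣-x-1 = subst (_ ∣ᶻ_) (sym (-y-1≡-[y+1] x)) (ℤᵈ.∣m⇒∣-m p∣x+1)
  p^j+e∣[-x]ⁿ-1 : + (p ^ (j + e)) ∣ᶻ (-ᶻ x) ^ᶻ (p ^ e * r) -ᶻ 1ℤ
  p^j+e∣[-x]ⁿ-1 = subst (_ ∣ᶻ_) (sym [-x]ⁿ-1≡-[xⁿ+1]) (ℤᵈ.∣m⇒∣-m p^j+e∣xⁿ+1)
  p^j∣-[x+1] : + (p ^ j) ∣ᶻ -ᶻ (x +ᶻ 1ℤ)
  p^j∣-[x+1] = subst (_ ∣ᶻ_) (-y-1≡-[y+1] x)
    (lifting-the-exponent p-prime 2∤p p∤r p∣-x-1 e j p^j+e∣[-x]ⁿ-1)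

roughPrimeDivisor : ∀ {n} → 2 ≤ n → ∃[ p ] Prime p × p ∣ n × p Rough n
roughPrimeDivisor {n} 2≤n = search (n ∸ 2) 2 (ℕ.m+[n∸m]≡n 2≤n) ℕ.≤-refl 2-rough
  where
  search : ∀ d k → k + d ≡ n → 2 ≤ k → k Rough n → ∃[ p ] Prime p × p ∣ n × p Rough n
  search d k k+d≡n 2≤k k-rough with k ∣? n
  ... | yes k∣n = k , rough∧∣⇒prime ⦃ n>1⇒nonTrivial 2≤k ⦄ k-rough k∣n , k∣n , k-rough
  search zero    k k+0≡n 2≤k k-rough | no k∤n =
    ⊥-elim (k∤n (subst (k ∣_) (trans (sym (ℕ.+-identityʳ k)) k+0≡n) ∣-refl))
  search (suc d) k k+d+1≡n 2≤k k-rough | no k∤n =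
    search d (suc k) (trans (sym (ℕ.+-suc k d)) k+d+1≡n) (ℕ.m≤n⇒m≤1+n 2≤k) (∤⇒rough-suc k∤n k-rough)

rough⇒coprime : ∀ {p n d} → .{{NonZero n}} → 2 ≤ p → p Rough n → d ∣ p ∸ 1 → Coprime d n
rough⇒coprime {n = n} _ _ _ {zero} (_ , 0∣n) = ⊥-elim (≢-nonZero⁻¹ n (0∣⇒≡0 0∣n))
rough⇒coprime _ _ _ {suc zero} _ = refl
rough⇒coprime {suc zero} (s≤s ()) _ _ {suc (suc i)} _
rough⇒coprime {suc (suc p′)} _ p-rough d∣p-1 {suc (suc i)} (i∣d , i∣n) =
  ⊥-elim (p-rough (hasNonTrivialDivisor (s≤s (∣⇒≤ (∣-trans i∣d d∣p-1))) i∣n))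

factorOut : ∀ {p} → 2 ≤ p → ∀ n → .{{NonZero n}} → ∃[ e ] ∃[ r ] n ≡ p ^ e * r × ¬ p ∣ r
factorOut {p} 2≤p n = go n (<-wellFounded n)
  where
  go : ∀ n → .{{NonZero n}} → Acc _<_ n → ∃[ e ] ∃[ r ] n ≡ p ^ e * r × ¬ p ∣ r
  go n (acc rec) with p ∣? n
  ... | no p∤n = 0 , n , sym (ℕ.*-identityˡ n) , p∤n
  ... | yes (divides q refl) with go q ⦃ ℕ.m*n≢0⇒m≢0 q ⦄ (rec (ℕ.m<m*n q p ⦃ ℕ.m*n≢0⇒m≢0 q ⦄ 2≤p))
  ...   | e , r , refl , p∤r = suc e , r , reorder (p ^ e) r p , p∤r
    where
    reorder : ∀ a r p → a * r * p ≡ p * a * r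
    reorder = solveℕ-∀

∣aⁿ+1⇒∣aᶜ-1 : ∀ {q} a n c → Prime q → ¬ q ∣ a → q ∣ a ^ n + 1 → gcd (n * 2) (q ∸ 1) ∣ c →
              + q ∣ᶻ (+ a) ^ᶻ c -ᶻ 1ℤ
∣aⁿ+1⇒∣aᶜ-1 {q} a n c q-prime q∤a q∣aⁿ+1 g∣c = ∣xᵈ-1⇒∣xⁿ-1 g∣c
  (∣xᵃ-1⇒∣xᵇ-1⇒∣x^gcd-1 (n * 2) (q ∸ 1) q∣a²ⁿ-1 (p∣aᵖ⁻¹-1 q-prime q∤a))
  where
  x = + a
  difference-of-squares : ∀ X → X *ᶻ (X *ᶻ 1ℤ) -ᶻ 1ℤ ≡ (X -ᶻ 1ℤ) *ᶻ (X +ᶻ 1ℤ)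
  difference-of-squares = solve-∀
  q∣a²ⁿ-1 : + q ∣ᶻ x ^ᶻ (n * 2) -ᶻ 1ℤ
  q∣a²ⁿ-1 = subst (_ ∣ᶻ_) (trans (sym (difference-of-squares (x ^ᶻ n))) (cong (_-ᶻ 1ℤ) (ℤ.^-*-assoc x n 2)))
    (ℤᵈ.∣n⇒∣m*n (x ^ᶻ n -ᶻ 1ℤ) (∣mⁿ+1⇒∣ᶻ a n q∣aⁿ+1))

-- Since no prime below p divides n, gcd(2n, p − 1) ∣ 2, so m² ≡ 1 (mod p).
rough-prime∣m+1 : ∀ {p m n} → Prime p → ¬ 2 ∣ p → 1 ≤ n → p ∣ n → p Rough n → p ∣ m ^ n + 1 →
                  + p ∣ᶻ + m +ᶻ 1ℤ
rough-prime∣m+1 {p} {m} {n} p-prime 2∤p 1≤n p∣n p-rough p∣mⁿ+1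
  with euclidsLemmaᶻ (+ m -ᶻ 1ℤ) (+ m +ᶻ 1ℤ) p-prime
         (subst (_ ∣ᶻ_) (difference-of-squares (+ m)) (∣aⁿ+1⇒∣aᶜ-1 m n 2 p-prime p∤m p∣mⁿ+1 g∣2))
  where
  instance _ = >-nonZero 1≤n
  p∤m : ¬ p ∣ m
  p∤m p∣m = prime∤1 p-prime (∣m+n∣m⇒∣n p∣mⁿ+1 (∣m⇒∣mⁿ 1≤n p∣m))
  g∣2 : gcd (n * 2) (p ∸ 1) ∣ 2
  g∣2 = coprime-divisor (rough⇒coprime (prime⇒2≤p p-prime) p-rough (gcd[m,n]∣n (n * 2) (p ∸ 1)))
                        (gcd[m,n]∣m (n * 2) (p ∸ 1))
  difference-of-squares : ∀ x → x *ᶻ (x *ᶻ 1ℤ) -ᶻ 1ℤ ≡ (x -ᶻ 1ℤ) *ᶻ (x +ᶻ 1ℤ)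
  difference-of-squares = solve-∀
... | inj₂ p∣m+1 = p∣m+1
... | inj₁ p∣m-1 = ⊥-elim (2∤p (subst (_∣ p) (prime∣prime⇒≡ p-prime prime[2] p∣2) ∣-refl))
  where
  p∣2 : p ∣ 2
  p∣2 = ℤᵈ.∣⇒∣ᵤ (∣X-1⇒∣X+1⇒∣2 ((+ m) ^ᶻ n) (∣x-1⇒∣xⁿ-1 n p∣m-1) (∣mⁿ+1⇒∣ᶻ m n p∣mⁿ+1))

4∣2ᵐ : ∀ {m} → 2 ≤ m → 4 ∣ 2 ^ m
4∣2ᵐ {suc zero}    (s≤s ())
4∣2ᵐ {suc (suc m)} _ = divides (2 ^ m) (regroup (2 ^ m))
  where
  regroup : ∀ X → 2 * (2 * X) ≡ X * 4
  regroup = solveℕ-∀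

4∣odd²-1 : ∀ j → + 4 ∣ᶻ (+ suc (2 * j)) ^ᶻ 2 -ᶻ 1ℤ
4∣odd²-1 j = divides (+ j *ᶻ + j +ᶻ + j)
  (trans (cong (λ z → (1ℤ +ᶻ z) ^ᶻ 2 -ᶻ 1ℤ) (ℤ.pos-* 2 j)) (expand (+ j)))
  where
  expand : ∀ J → (1ℤ +ᶻ + 2 *ᶻ J) *ᶻ ((1ℤ +ᶻ + 2 *ᶻ J) *ᶻ 1ℤ) -ᶻ 1ℤ ≡ (J *ᶻ J +ᶻ J) *ᶻ + 4
  expand = solve-∀

4∤mⁿ+1 : ∀ {m n} → 1 ≤ n → 2 ∣ n → ¬ 4 ∣ m ^ n + 1
4∤mⁿ+1 {m} 1≤n 2∣n 4∣mⁿ+1 with 2 ∣? m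
... | yes 2∣m = prime∤1 prime[2] (∣m+n∣m⇒∣n (∣-trans (divides 2 refl) 4∣mⁿ+1) (∣m⇒∣mⁿ 1≤n 2∣m))
... | no 2∤m with ∤2⇒odd 2∤m | 2∣n
...   | j , refl | divides k refl = ℕ.<⇒≱ (s≤s (s≤s (s≤s z≤n))) (∣⇒≤ (ℤᵈ.∣⇒∣ᵤ 4∣2))
  where
  x = + suc (2 * j)
  4∣xⁿ-1 : + 4 ∣ᶻ x ^ᶻ (k * 2) -ᶻ 1ℤ
  4∣xⁿ-1 = subst (λ e → + 4 ∣ᶻ x ^ᶻ e -ᶻ 1ℤ) (ℕ.*-comm 2 k)
    (subst (λ z → + 4 ∣ᶻ z -ᶻ 1ℤ) (ℤ.^-*-assoc x 2 k) (∣x-1⇒∣xⁿ-1 k (4∣odd²-1 j)))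
  4∣2 : + 4 ∣ᶻ + 2
  4∣2 = ∣X-1⇒∣X+1⇒∣2 (x ^ᶻ (k * 2)) 4∣xⁿ-1 (∣mⁿ+1⇒∣ᶻ (suc (2 * j)) (k * 2) 4∣mⁿ+1)

even-case : ∀ {m n} → 2 ≤ m → 1 ≤ n → 2 ∣ n → ¬ n ^ m ∣ m ^ n + 1
even-case {m} 2≤m 1≤n 2∣n nᵐ∣mⁿ+1 =
  4∤mⁿ+1 1≤n 2∣n (∣-trans (4∣2ᵐ 2≤m) (∣-trans (^-monoˡ-∣ m 2∣n) nᵐ∣mⁿ+1))

k+5≤3^[k+2] : ∀ k → k + 5 ≤ 3 ^ (2 + k)
k+5≤3^[k+2] zero    = ℕ.m≤m+n 5 4
k+5≤3^[k+2] (suc k) = begin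
  suc k + 5           ≤⟨ ℕ.m≤m+n (suc k + 5) (2 * k + 9) ⟩
  suc k + 5 + (2 * k + 9) ≡⟨ regroup k ⟩
  3 * (k + 5)         ≤⟨ ℕ.*-monoʳ-≤ 3 (k+5≤3^[k+2] k) ⟩
  3 ^ (3 + k)         ∎
  where
  open ℕ.≤-Reasoning
  regroup : ∀ k → suc k + 5 + (2 * k + 9) ≡ 3 * (k + 5)
  regroup = solveℕ-∀

3ᵏ≤k+2⇒k≤1 : ∀ k → 3 ^ k ≤ suc k + 1 → k ≤ 1
3ᵏ≤k+2⇒k≤1 zero          _  = z≤n
3ᵏ≤k+2⇒k≤1 (suc zero)    _  = ℕ.≤-refl
3ᵏ≤k+2⇒k≤1 (suc (suc k)) le = ⊥-elim (ℕ.<⇒≱ (ℕ.≤-trans (ℕ.≤-reflexive (shift k)) (k+5≤3^[k+2] k)) le)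
  where
  shift : ∀ k → suc (suc (suc (suc k)) + 1) ≡ k + 5
  shift = solveℕ-∀

pᵐ′ᵉ∣m′+2⇒m′≡1 : ∀ {p e m′} → 3 ≤ p → 1 ≤ e → 1 ≤ m′ → p ^ (m′ * e) ∣ suc m′ + 1 →
                 m′ ≡ 1 × p ^ e ≡ 3 × p ≡ 3
pᵐ′ᵉ∣m′+2⇒m′≡1 {p} {e} {m′} 3≤p 1≤e 1≤m′ pᵐ′ᵉ∣m+1
  with ℕ.≤-antisym (3ᵏ≤k+2⇒k≤1 m′ 3ᵐ′≤m+1) 1≤m′
  where
  instance
    _ = >-nonZero 1≤e
    _ = >-nonZero (ℕ.≤-trans (s≤s z≤n) 3≤p)
  3ᵐ′≤m+1 : 3 ^ m′ ≤ suc m′ + 1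
  3ᵐ′≤m+1 = ℕ.≤-trans (ℕ.^-monoˡ-≤ m′ 3≤p) (ℕ.≤-trans (ℕ.^-monoʳ-≤ p (ℕ.m≤m*n m′ e)) (∣⇒≤ pᵐ′ᵉ∣m+1))
... | refl = refl , ℕ.≤-antisym pᵉ≤3 (ℕ.≤-trans 3≤p p≤pᵉ) , ℕ.≤-antisym (ℕ.≤-trans p≤pᵉ pᵉ≤3) 3≤p
  where
  instance _ = >-nonZero (ℕ.≤-trans (s≤s z≤n) 3≤p)
  pᵉ≤3 : p ^ e ≤ 3
  pᵉ≤3 = subst (λ k → p ^ k ≤ 3) (ℕ.*-identityˡ e) (∣⇒≤ pᵐ′ᵉ∣m+1)
  p≤pᵉ : p ≤ p ^ e
  p≤pᵉ = subst (_≤ p ^ e) (ℕ.*-identityʳ p) (ℕ.^-monoʳ-≤ p 1≤e)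

-- With m = m′ + 1: p^(em) ∣ nᵐ ∣ mⁿ + 1, and lifting the exponent removes the factor pᵉ of n.
pᵐ′ᵉ∣m+1 : ∀ {p m′ n e r} → Prime p → ¬ 2 ∣ n → p ∣ n → p Rough n → n ≡ p ^ e * r → ¬ p ∣ r →
           n ^ suc m′ ∣ suc m′ ^ n + 1 → p ^ (m′ * e) ∣ suc m′ + 1
pᵐ′ᵉ∣m+1 {p} {m′} {n} {e} {r} p-prime 2∤n p∣n p-rough n≡pᵉr p∤r nᵐ∣mⁿ+1 = ℤᵈ.∣⇒∣ᵤ
  (lifting-the-exponent⁺ p-prime 2∤p p∤r p∣m+1 e (m′ * e) (subst (λ k → ¬ 2 ∣ k) n≡pᵉr 2∤n)
    (∣mⁿ+1⇒∣ᶻ m (p ^ e * r) (subst (λ k → p ^ (m′ * e + e) ∣ m ^ k + 1) n≡pᵉr (∣-trans pᵐ′ᵉ⁺ᵉ∣nᵐ nᵐ∣mⁿ+1))))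
  where
  m = suc m′
  2∤p : ¬ 2 ∣ p
  2∤p 2∣p = 2∤n (∣-trans 2∣p p∣n)
  1≤n : 1 ≤ n
  1≤n = ℕ.n≢0⇒n>0 (λ n≡0 → 2∤n (subst (2 ∣_) (sym n≡0) (divides 0 refl)))
  p∣m+1 : + p ∣ᶻ + m +ᶻ 1ℤ
  p∣m+1 = rough-prime∣m+1 p-prime 2∤p 1≤n p∣n p-rough (∣-trans p∣n (∣-trans (m∣m*n (n ^ m′)) nᵐ∣mⁿ+1))
  regroup : ∀ e m′ → e * suc m′ ≡ m′ * e + e
  regroup = solveℕ-∀
  pᵐ′ᵉ⁺ᵉ∣nᵐ : p ^ (m′ * e + e) ∣ n ^ m
  pᵐ′ᵉ⁺ᵉ∣nᵐ = subst (_∣ n ^ m) (trans (ℕ.^-*-assoc p e m) (cong (p ^_) (regroup e m′)))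
    (^-monoˡ-∣ m (subst (p ^ e ∣_) (sym n≡pᵉr) (m∣m*n r)))

7∤2ⁿ+1 : ∀ n → ¬ 7 ∣ 2 ^ n + 1
7∤2ⁿ+1 0 = from-no (7 ∣? 2)
7∤2ⁿ+1 1 = from-no (7 ∣? 3)
7∤2ⁿ+1 2 = from-no (7 ∣? 5)
7∤2ⁿ+1 (suc (suc (suc n))) 7∣2ⁿ⁺³+1 =
  7∤2ⁿ+1 n (∣m+n∣m⇒∣n (subst (7 ∣_) (regroup (2 ^ n)) 7∣2ⁿ⁺³+1) (m∣m*n (2 ^ n)))
  where
  regroup : ∀ X → 2 * (2 * (2 * X)) + 1 ≡ 7 * X + (X + 1)
  regroup = solveℕ-∀

prime∣7*9⇒≡7⊎≡3 : ∀ {q} → Prime q → q ∣ 7 * (3 * 3) → q ≡ 7 ⊎ q ≡ 3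
prime∣7*9⇒≡7⊎≡3 q-prime q∣63 = Sum.map (prime∣prime⇒≡ q-prime (from-yes (prime? 7)))
  (prime∣prime⇒≡ q-prime (from-yes (prime? 3)) ∘ Sum.reduce ∘ euclidsLemma 3 3 q-prime)
  (euclidsLemma 7 (3 * 3) q-prime q∣63)

-- The least prime factor q of r is neither 2 nor 3, so gcd(2n, q − 1) ∣ 6 and q ∣ 2⁶ − 1 = 7 · 9.
cofactor≡1 : ∀ {n r} → n ≡ 3 * r → ¬ 3 ∣ r → ¬ 2 ∣ n → n ^ 2 ∣ 2 ^ n + 1 → r ≡ 1
cofactor≡1 {r = zero}       _    3∤r _ _ = ⊥-elim (3∤r (divides 0 refl))
cofactor≡1 {r = suc zero}   _    _   _ _ = refl
cofactor≡1 {n} {r@(suc (suc _))} refl 3∤r 2∤n n²∣2ⁿ+1 with roughPrimeDivisor {r} (s≤s (s≤s z≤n))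
... | q , q-prime , q∣r , q-rough = ⊥-elim (Sum.[ q≢7 , q≢3 ] (prime∣7*9⇒≡7⊎≡3 q-prime q∣63))
  where
  q∣n : q ∣ n
  q∣n = ∣n⇒∣m*n 3 q∣r
  q∣2ⁿ+1 : q ∣ 2 ^ n + 1
  q∣2ⁿ+1 = ∣-trans q∣n (∣-trans (m∣m*n (n ^ 1)) n²∣2ⁿ+1)
  q∤2 : ¬ q ∣ 2
  q∤2 q∣2 = 2∤n (subst (_∣ n) (prime∣prime⇒≡ q-prime prime[2] q∣2) q∣n)
  g∣6 : gcd (n * 2) (q ∸ 1) ∣ 6
  g∣6 = coprime-divisor (rough⇒coprime (prime⇒2≤p q-prime) q-rough (gcd[m,n]∣n (n * 2) (q ∸ 1)))
    (subst (gcd (n * 2) (q ∸ 1) ∣_) (regroup r) (gcd[m,n]∣m (n * 2) (q ∸ 1)))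
    where
    regroup : ∀ r → 3 * r * 2 ≡ r * 6
    regroup = solveℕ-∀
  q∣63 : q ∣ 7 * (3 * 3)
  q∣63 = ℤᵈ.∣⇒∣ᵤ (∣aⁿ+1⇒∣aᶜ-1 2 n 6 q-prime q∤2 q∣2ⁿ+1 g∣6)
  q≢7 : ¬ q ≡ 7
  q≢7 q≡7 = 7∤2ⁿ+1 n (subst (_∣ 2 ^ n + 1) q≡7 q∣2ⁿ+1)
  q≢3 : ¬ q ≡ 3
  q≢3 q≡3 = 3∤r (subst (_∣ r) q≡3 q∣r)

odd-case : ∀ {m n} → 2 ≤ m → 2 ≤ n → ¬ 2 ∣ n → n ^ m ∣ m ^ n + 1 → m ≡ 2 × n ≡ 3
odd-case {suc m′} {n} (s≤s 1≤m′) 2≤n 2∤n nᵐ∣mⁿ+1 with roughPrimeDivisor 2≤n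
... | p , p-prime , p∣n , p-rough with factorOut (prime⇒2≤p p-prime) n ⦃ >-nonZero (ℕ.<⇒≤ 2≤n) ⦄
...   | e , r , n≡pᵉr , p∤r =
  let m′≡1 , pᵉ≡3 , p≡3 = pᵐ′ᵉ∣m′+2⇒m′≡1 3≤p 1≤e 1≤m′
                            (pᵐ′ᵉ∣m+1 p-prime 2∤n p∣n p-rough n≡pᵉr p∤r nᵐ∣mⁿ+1)
      n≡3r = trans n≡pᵉr (cong (_* r) pᵉ≡3)
      r≡1  = cofactor≡1 n≡3r (subst (λ q → ¬ q ∣ r) p≡3 p∤r) 2∤n
                        (subst (λ k → n ^ suc k ∣ suc k ^ n + 1) m′≡1 nᵐ∣mⁿ+1)
  in cong suc m′≡1 , trans n≡3r (cong (3 *_) r≡1)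
  where
  3≤p : 3 ≤ p
  3≤p = ℕ.≤∧≢⇒< (prime⇒2≤p p-prime) (λ 2≡p → 2∤n (subst (_∣ n) (sym 2≡p) p∣n))
  1≤e : 1 ≤ e
  1≤e = ℕ.n≢0⇒n>0 λ e≡0 → p∤r
    (subst (p ∣_) (trans n≡pᵉr (trans (cong (λ k → p ^ k * r) e≡0) (ℕ.*-identityˡ r))) p∣n)

nᵐ∣mⁿ+1⇒solution : ∀ {m n} → 1 ≤ m → 1 ≤ n → n ^ m ∣ m ^ n + 1 →
                    ((m ≡ 2) × (n ≡ 3)) ⊎ ((m ≡ 1) × (n ≡ 2)) ⊎ (n ≡ 1)
nᵐ∣mⁿ+1⇒solution {suc zero} {n} _ _ nᵐ∣mⁿ+1
  with prime⇒irreducible prime[2] (subst₂ _∣_ (ℕ.*-identityʳ n) (cong (_+ 1) (ℕ.^-zeroˡ n)) nᵐ∣mⁿ+1)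
... | inj₁ n≡1 = inj₂ (inj₂ n≡1)
... | inj₂ n≡2 = inj₂ (inj₁ (refl , n≡2))
nᵐ∣mⁿ+1⇒solution {suc (suc _)} {suc zero} _ _ _ = inj₂ (inj₂ refl)
nᵐ∣mⁿ+1⇒solution {suc (suc _)} {n@(suc (suc _))} _ 1≤n nᵐ∣mⁿ+1 with 2 ∣? n
... | yes 2∣n = ⊥-elim (even-case (s≤s (s≤s z≤n)) 1≤n 2∣n nᵐ∣mⁿ+1)
... | no 2∤n  = inj₁ (odd-case (s≤s (s≤s z≤n)) (s≤s (s≤s z≤n)) 2∤n nᵐ∣mⁿ+1)

solution⇒nᵐ∣mⁿ+1 : ∀ {m n} → ((m ≡ 2) × (n ≡ 3)) ⊎ ((m ≡ 1) × (n ≡ 2)) ⊎ (n ≡ 1) → n ^ m ∣ m ^ n + 1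
solution⇒nᵐ∣mⁿ+1     (inj₁ (refl , refl))        = ∣-refl
solution⇒nᵐ∣mⁿ+1     (inj₂ (inj₁ (refl , refl))) = ∣-refl
solution⇒nᵐ∣mⁿ+1 {m} (inj₂ (inj₂ refl))          = subst (_∣ m ^ 1 + 1) (sym (ℕ.^-zeroˡ m)) (1∣ _)

corollary1 : (m n : ℕ) → 1 ≤ m → 1 ≤ n →
    ((n ^ m) ∣ (m ^ n + 1)) ⇔ (((m ≡ 2) × (n ≡ 3)) ⊎ ((m ≡ 1) × (n ≡ 2)) ⊎ (n ≡ 1))
corollary1 m n 1≤m 1≤n = mk⇔ (nᵐ∣mⁿ+1⇒solution {m} {n} 1≤m 1≤n) (solution⇒nᵐ∣mⁿ+1 {m} {n})
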